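{- If $\Gamma\le\mathrm{Aut}(\mathbb{L}^2)$ has minimum displacement at least $3$, then $\Gamma$ is torsion-free.
   Context: $\mathbb{L}^2$ is the graph on $\mathbb{Z}^2$ with edges between points at Euclidean distance 1. The minimum displacement of $\Gamma\le\mathrm{Aut}(\mathbb{L}^2)$ is $\min\{d_{\mathbb{L}^2}(x,\gamma(x)): x\in\mathbb{Z}^2,\ \gamma\in\Gamma\setminus\{\mathrm{Id}\}\}$, where $d_{\mathbb{L}^2}$ is graph distance. A group is torsion-free if its only element of finite order is the identity. -}

module Defs where

open import Data.Nat using (ℕ; zero; suc; _≤_)
open import Data.Integer using (ℤ; +_; _-_; _*_; _+_)
open import Data.Product using (_×_; _,_; proj₁; proj₂)
open import Relation.Binary.PropositionalEquality using (_≡_)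
open import Relation.Nullary using (¬_)

Point : Set
Point = ℤ × ℤ

Adj : Point → Point → Set
Adj (x₁ , x₂) (y₁ , y₂) = (x₁ - y₁) * (x₁ - y₁) + (x₂ - y₂) * (x₂ - y₂) ≡ + 1

data Walk : Point → Point → ℕ → Set where
  nil  : ∀ x → Walk x x zero
  step : ∀ {x y z n} → Adj x y → Walk y z n → Walk x z (suc n)

DistAtLeast : ℕ → Point → Point → Set
DistAtLeast k x y = ∀ n → Walk x y n → k ≤ n

record Aut : Set where
  field
    fun    : Point → Point
    inv    : Point → Point
    inv-l  : ∀ x → inv (fun x) ≡ x
    inv-r  : ∀ x → fun (inv x) ≡ x
    adj⇒   : ∀ x y → Adj x y → Adj (fun x) (fun y)
    adj⇐   : ∀ x y → Adj (fun x) (fun y) → Adj x y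
open Aut public

_≈ᴬ_ : Aut → Aut → Set
f ≈ᴬ g = ∀ x → fun f x ≡ fun g x

idᴬ : Aut
idᴬ = record { fun = λ x → x ; inv = λ x → x
             ; inv-l = λ _ → Relation.Binary.PropositionalEquality.refl
             ; inv-r = λ _ → Relation.Binary.PropositionalEquality.refl
             ; adj⇒ = λ _ _ a → a ; adj⇐ = λ _ _ a → a }

_∘ᴬ_ : Aut → Aut → Aut
f ∘ᴬ g = record
  { fun = λ x → fun f (fun g x)
  ; inv = λ x → inv g (inv f x)
  ; inv-l = λ x → trans (cong (inv g) (inv-l f (fun g x))) (inv-l g x)
  ; inv-r = λ x → trans (cong (fun f) (inv-r g (inv f x))) (inv-r f x)
  ; adj⇒ = λ x y a → adj⇒ f _ _ (adj⇒ g x y a)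
  ; adj⇐ = λ x y a → adj⇐ g x y (adj⇐ f _ _ a) }
  where open Relation.Binary.PropositionalEquality using (trans; cong)

_⁻¹ᴬ : Aut → Aut
f ⁻¹ᴬ = record
  { fun = inv f ; inv = fun f ; inv-l = inv-r f ; inv-r = inv-l f
  ; adj⇒ = λ x y a → adj⇐ f _ _ (subst₂ Adj (sym (inv-r f x)) (sym (inv-r f y)) a)
  ; adj⇐ = λ x y a → subst₂ Adj (inv-r f x) (inv-r f y) (adj⇒ f _ _ a) }
  where open Relation.Binary.PropositionalEquality using (subst₂; sym)

_^ᴬ_ : Aut → ℕ → Aut
f ^ᴬ zero  = idᴬ
f ^ᴬ suc n = f ∘ᴬ (f ^ᴬ n)

record Subgroup : Set₁ where
  field
    _∈Γ    : Aut → Set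
    resp   : ∀ {f g} → f ≈ᴬ g → f ∈Γ → g ∈Γ
    id∈    : idᴬ ∈Γ
    ∘∈     : ∀ {f g} → f ∈Γ → g ∈Γ → (f ∘ᴬ g) ∈Γ
    ⁻¹∈    : ∀ {f} → f ∈Γ → (f ⁻¹ᴬ) ∈Γ
open Subgroup public

MinDisplacementAtLeast : ℕ → Subgroup → Set
MinDisplacementAtLeast k Γ =
  ∀ (γ : Aut) → _∈Γ Γ γ → ¬ (γ ≈ᴬ idᴬ) → ∀ x → DistAtLeast k x (fun γ x)

TorsionFree : Subgroup → Set
TorsionFree Γ = ∀ (γ : Aut) → _∈Γ Γ γ → ∀ (n : ℕ) → 1 ≤ n → (γ ^ᴬ n) ≈ᴬ idᴬ → γ ≈ᴬ idᴬ

-- Every automorphism of 𝕃² is an affine map x ↦ A x + c whose linear part A is one of the eight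
-- symmetries of the square: it maps unit steps to unit steps, and the unique-common-neighbour
-- structure of the lattice forces the step taken by the image of a unit step to be independent of
-- the base point. For γ of finite order, every additive functional fixed by A is fixed by γ, since
-- it is shifted by a constant at each application. A case analysis on A then finishes the proof:
-- translations of finite order are trivial; a half-turn, and a reflection of finite order (whose
-- glide therefore vanishes), move some point by a vector in {0,1}², hence by graph distance at
-- most 2; and the square of a quarter-turn is a half-turn.
module Submission where

open import Defs
open import Data.Nat as ℕ using (ℕ; zero; suc; _<_; s≤s; z≤n; z<s)
import Data.Nat.Properties as ℕ
open import Data.Fin using (Fin; zero; suc)
open import Data.Fin.Properties using (all?) renaming (_≟_ to _≟ᵈ_)
open import Data.Integer as ℤ using (ℤ; +_; -[1+_]; _+_; _-_; _*_; -_)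
import Data.Integer.Properties as ℤ
open import Data.Integer.DivMod using (_/ℕ_; _%ℕ_; n%ℕd<d; a≡a%ℕn+[a/ℕn]*n)
open import Data.Integer.Tactic.RingSolver using (solve-∀)
open import Data.Product using (∃; ∃₂; _×_; _,_; proj₁; proj₂)
open import Data.Product.Properties using (≡-dec)
open import Data.Sum using (_⊎_; inj₁; inj₂)
open import Data.Empty using (⊥-elim)
open import Relation.Nullary using (¬_; Dec; yes; no; ¬?)
open import Relation.Nullary.Decidable using (from-yes; _→-dec_; _⊎-dec_)
open import Relation.Binary.PropositionalEquality
open import Algebra.Properties.AbelianGroup ℤ.+-0-abelianGroup using (∙-cancelˡ; identityˡ-unique; identityʳ-unique)

-- Directions are encoded as Fin 4 so that statements quantified over them can be decided.
Dir : Set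
Dir = Fin 4

pattern R = zero
pattern L = suc zero
pattern U = suc (suc zero)
pattern D = suc (suc (suc zero))

unit : Dir → Point
unit R = + 1 , + 0
unit L = -[1+ 0 ] , + 0
unit U = + 0 , + 1
unit D = + 0 , -[1+ 0 ]

opposite : Dir → Dir
opposite R = L
opposite L = R
opposite U = D
opposite D = U

origin : Point
origin = + 0 , + 0

infixl 6 _⊕_
_⊕_ : Point → Point → Point
(x₁ , x₂) ⊕ (y₁ , y₂) = x₁ + y₁ , x₂ + y₂

infix 4 _≟ᵖ_
_≟ᵖ_ : (p q : Point) → Dec (p ≡ q)
_≟ᵖ_ = ≡-dec ℤ._≟_ ℤ._≟_

opposite-involutive : ∀ d → opposite (opposite d) ≡ d
opposite-involutive R = refl
opposite-involutive L = refl
opposite-involutive U = refl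
opposite-involutive D = refl

opposite-injective : ∀ {a b} → opposite a ≡ opposite b → a ≡ b
opposite-injective {a} {b} eq =
  trans (sym (opposite-involutive a)) (trans (cong opposite eq) (opposite-involutive b))

opposite-≢ : ∀ d → d ≢ opposite d
opposite-≢ R ()
opposite-≢ L ()
opposite-≢ U ()
opposite-≢ D ()

unit-opposite : ∀ d → unit d ⊕ unit (opposite d) ≡ origin
unit-opposite R = refl
unit-opposite L = refl
unit-opposite U = refl
unit-opposite D = refl

unit-injective : ∀ a b → unit a ≡ unit b → a ≡ b
unit-injective = from-yes (all? λ a → all? λ b → unit a ≟ᵖ unit b →-dec a ≟ᵈ b)

units-cancel : ∀ a b → unit a ⊕ unit b ≡ origin → b ≡ opposite a
units-cancel = from-yes (all? λ a → all? λ b → unit a ⊕ unit b ≟ᵖ origin →-dec b ≟ᵈ opposite a)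

two-step-paths : ∀ a b e e′ → a ≢ b → unit a ⊕ unit e ≡ unit b ⊕ unit e′ → e ≡ opposite a ⊎ e ≡ b
two-step-paths = from-yes (all? λ a → all? λ b → all? λ e → all? λ e′ →
  ¬? (a ≟ᵈ b) →-dec unit a ⊕ unit e ≟ᵖ unit b ⊕ unit e′ →-dec (e ≟ᵈ opposite a ⊎-dec e ≟ᵈ b))

⊕-assoc : ∀ x y z → (x ⊕ y) ⊕ z ≡ x ⊕ (y ⊕ z)
⊕-assoc x y z = cong₂ _,_ (ℤ.+-assoc (proj₁ x) (proj₁ y) (proj₁ z)) (ℤ.+-assoc (proj₂ x) (proj₂ y) (proj₂ z))

⊕-identityʳ : ∀ x → x ⊕ origin ≡ x
⊕-identityʳ x = cong₂ _,_ (ℤ.+-identityʳ (proj₁ x)) (ℤ.+-identityʳ (proj₂ x))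

⊕-cancelˡ : ∀ x y z → x ⊕ y ≡ x ⊕ z → y ≡ z
⊕-cancelˡ x y z eq = cong₂ _,_ (∙-cancelˡ (proj₁ x) (proj₁ y) (proj₁ z) (cong proj₁ eq))
                               (∙-cancelˡ (proj₂ x) (proj₂ y) (proj₂ z) (cong proj₂ eq))

⊕-swap : ∀ x y z → (x ⊕ y) ⊕ z ≡ (x ⊕ z) ⊕ y
⊕-swap x y z = cong₂ _,_ (swap (proj₁ x) (proj₁ y) (proj₁ z)) (swap (proj₂ x) (proj₂ y) (proj₂ z))
  where
    swap : ∀ a b c → (a + b) + c ≡ (a + c) + b
    swap = solve-∀

⊕-returns : ∀ x y z → (x ⊕ y) ⊕ z ≡ x → y ⊕ z ≡ origin
⊕-returns x y z eq = ⊕-cancelˡ x (y ⊕ z) origin (trans (sym (⊕-assoc x y z)) (trans eq (sym (⊕-identityʳ x))))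

⊕-unit-opposite : ∀ x d → (x ⊕ unit d) ⊕ unit (opposite d) ≡ x
⊕-unit-opposite x d = trans (⊕-assoc x (unit d) (unit (opposite d)))
                            (trans (cong (x ⊕_) (unit-opposite d)) (⊕-identityʳ x))

norm-one : ∀ a b → a * a + b * b ≡ + 1 → ∃ λ d → unit d ≡ (- a , - b)
norm-one (+ 0)            (+ 0)            ()
norm-one (+ 0)            (+ 1)            _ = D , refl
norm-one (+ 0)            (+ suc (suc _))  ()
norm-one (+ 0)            -[1+ 0 ]         _ = U , refl
norm-one (+ 0)            -[1+ suc _ ]     ()
norm-one (+ 1)            (+ 0)            _ = L , refl
norm-one (+ 1)            (+ suc _)        ()
norm-one (+ 1)            -[1+ _ ]         ()
norm-one (+ suc (suc _))  (+ 0)            ()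
norm-one (+ suc (suc _))  (+ suc _)        ()
norm-one (+ suc (suc _))  -[1+ _ ]         ()
norm-one -[1+ 0 ]         (+ 0)            _ = R , refl
norm-one -[1+ 0 ]         (+ suc _)        ()
norm-one -[1+ 0 ]         -[1+ _ ]         ()
norm-one -[1+ suc _ ]     (+ 0)            ()
norm-one -[1+ suc _ ]     (+ suc _)        ()
norm-one -[1+ suc _ ]     -[1+ _ ]         ()

adjacent-step : ∀ p q → Adj p q → ∃ λ d → q ≡ p ⊕ unit d
adjacent-step (p₁ , p₂) (q₁ , q₂) adj with norm-one (p₁ - q₁) (p₂ - q₂) adj
... | d , eq = d , cong₂ _,_ (trans (undo p₁ q₁) (cong (λ t → p₁ + t) (cong proj₁ (sym eq))))
                             (trans (undo p₂ q₂) (cong (λ t → p₂ + t) (cong proj₂ (sym eq))))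
  where
    undo : ∀ p q → q ≡ p + - (p - q)
    undo = solve-∀

step-adjacent : ∀ p d → Adj p (p ⊕ unit d)
step-adjacent (p₁ , p₂) d =
  subst₂ (λ a b → a * a + b * b ≡ + 1) (sym (undo p₁ (proj₁ (unit d)))) (sym (undo p₂ (proj₂ (unit d))))
    (norm d)
  where
    undo : ∀ p u → p - (p + u) ≡ - u
    undo = solve-∀
    norm : ∀ d → (- proj₁ (unit d)) * (- proj₁ (unit d)) + (- proj₂ (unit d)) * (- proj₂ (unit d)) ≡ + 1
    norm R = refl
    norm L = refl
    norm U = refl
    norm D = refl

common-neighbours : ∀ p a b z → a ≢ b → Adj (p ⊕ unit a) z → Adj (p ⊕ unit b) z →
                    z ≡ p ⊎ z ≡ (p ⊕ unit a) ⊕ unit b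
common-neighbours p a b z a≢b adj-a adj-b
  with adjacent-step (p ⊕ unit a) z adj-a | adjacent-step (p ⊕ unit b) z adj-b
... | e , z≡ae | e′ , z≡be′ = conclude (two-step-paths a b e e′ a≢b (⊕-cancelˡ p _ _
        (trans (sym (⊕-assoc p _ _)) (trans (sym z≡ae) (trans z≡be′ (⊕-assoc p _ _))))))
  where
    conclude : e ≡ opposite a ⊎ e ≡ b → z ≡ p ⊎ z ≡ (p ⊕ unit a) ⊕ unit b
    conclude (inj₁ refl) = inj₁ (trans z≡ae (⊕-unit-opposite p a))
    conclude (inj₂ refl) = inj₂ z≡ae

walk-to-corner : ∀ x {r₁ r₂} → r₁ < 2 → r₂ < 2 → ∃ λ n → n ℕ.≤ 2 × Walk x (x ⊕ (+ r₁ , + r₂)) n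
walk-to-corner x {0} {0} _ _ = 0 , z≤n , subst (λ y → Walk x y 0) (sym (⊕-identityʳ x)) (nil x)
walk-to-corner x {1} {0} _ _ = 1 , s≤s z≤n , step (step-adjacent x R) (nil _)
walk-to-corner x {0} {1} _ _ = 1 , s≤s z≤n , step (step-adjacent x U) (nil _)
walk-to-corner x {1} {1} _ _ = 2 , ℕ.≤-refl , subst (λ y → Walk x y 2) (⊕-assoc x (unit R) (unit U))
  (step (step-adjacent x R) (step (step-adjacent (x ⊕ unit R) U) (nil _)))
walk-to-corner x {suc (suc _)} (s≤s (s≤s ())) _
walk-to-corner x {_} {suc (suc _)} _ (s≤s (s≤s ()))

ℤ-shift-invariant⇒constant : ∀ {A : Set} (k : ℤ → A) → (∀ t → k (t + + 1) ≡ k t) → ∀ t → k t ≡ k (+ 0)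
ℤ-shift-invariant⇒constant k shift (+ zero)     = refl
ℤ-shift-invariant⇒constant k shift (+ suc n)    =
  trans (cong (λ m → k (+ m)) (ℕ.+-comm 1 n)) (trans (shift (+ n)) (ℤ-shift-invariant⇒constant k shift (+ n)))
ℤ-shift-invariant⇒constant k shift -[1+ zero ]  = sym (shift -[1+ 0 ])
ℤ-shift-invariant⇒constant k shift -[1+ suc n ] =
  trans (sym (shift -[1+ suc n ])) (ℤ-shift-invariant⇒constant k shift -[1+ n ])

step-invariant⇒constant : ∀ {A : Set} (h : Point → A) → (∀ x e → h (x ⊕ unit e) ≡ h x) → ∀ x → h x ≡ h origin
step-invariant⇒constant h shift (m , n) =
  trans (ℤ-shift-invariant⇒constant (λ t → h (t , n)) right m) (ℤ-shift-invariant⇒constant (λ t → h (+ 0 , t)) up n)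
  where
    right : ∀ t → h (t + + 1 , n) ≡ h (t , n)
    right t = trans (cong (λ s → h (t + + 1 , s)) (sym (ℤ.+-identityʳ n))) (shift (t , n) R)
    up : ∀ t → h (+ 0 , t + + 1) ≡ h (+ 0 , t)
    up t = shift (+ 0 , t) U

fun-injective : ∀ f {x y} → fun f x ≡ fun f y → x ≡ y
fun-injective f {x} {y} eq = trans (sym (inv-l f x)) (trans (cong (inv f) eq) (inv-l f y))

adj-pullback : ∀ f {y} w → Adj (fun f y) w → Adj y (inv f w)
adj-pullback f {y} w adj = adj⇐ f y (inv f w) (subst (Adj (fun f y)) (sym (inv-r f w)) adj)

module Derivative (f : Aut) where

  image-step : ∀ x d → ∃ λ d′ → fun f (x ⊕ unit d) ≡ fun f x ⊕ unit d′
  image-step x d = adjacent-step (fun f x) (fun f (x ⊕ unit d)) (adj⇒ f x (x ⊕ unit d) (step-adjacent x d))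

  ∂ : Point → Dir → Dir
  ∂ x d = proj₁ (image-step x d)

  ∂-step : ∀ x d → fun f (x ⊕ unit d) ≡ fun f x ⊕ unit (∂ x d)
  ∂-step x d = proj₂ (image-step x d)

  ∂-injective : ∀ x {e d} → ∂ x e ≡ ∂ x d → e ≡ d
  ∂-injective x {e} {d} eq = unit-injective e d (⊕-cancelˡ x (unit e) (unit d) (fun-injective f
    (trans (∂-step x e) (trans (cong (λ t → fun f x ⊕ unit t) eq) (sym (∂-step x d))))))

  -- x is the only common neighbour of x + d and x − d, so f⁻¹ of the far corner of the square
  -- spanned by ∂ x d and ∂ x (−d) is x; hence that square is degenerate.
  ∂-opposite : ∀ x d → ∂ x (opposite d) ≡ opposite (∂ x d)
  ∂-opposite x d = units-cancel (∂ x d) (∂ x (opposite d)) (⊕-returns (fun f x) _ _ w≡fx)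
    where
      w : Point
      w = (fun f x ⊕ unit (∂ x d)) ⊕ unit (∂ x (opposite d))
      w-adj : Adj (x ⊕ unit d) (inv f w)
      w-adj = adj-pullback f w (subst (λ y → Adj y w) (sym (∂-step x d))
        (step-adjacent (fun f x ⊕ unit (∂ x d)) (∂ x (opposite d))))
      w-adj′ : Adj (x ⊕ unit (opposite d)) (inv f w)
      w-adj′ = adj-pullback f w (subst₂ Adj (sym (∂-step x (opposite d)))
        (⊕-swap (fun f x) (unit (∂ x (opposite d))) (unit (∂ x d)))
        (step-adjacent (fun f x ⊕ unit (∂ x (opposite d))) (∂ x d)))
      fixes : inv f w ≡ x ⊎ inv f w ≡ (x ⊕ unit d) ⊕ unit (opposite d) → inv f w ≡ x
      fixes (inj₁ eq) = eq
      fixes (inj₂ eq) = trans eq (⊕-unit-opposite x d)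
      w≡fx : w ≡ fun f x
      w≡fx = trans (sym (inv-r f w)) (cong (fun f)
        (fixes (common-neighbours x d (opposite d) (inv f w) (opposite-≢ d) w-adj w-adj′)))

  ∂-forward : ∀ x d → ∂ (x ⊕ unit d) d ≡ ∂ x d
  ∂-forward x d =
    opposite-injective (units-cancel (∂ x d) (opposite (∂ y d)) (⊕-returns (fun f x) _ _ (sym loop)))
    where
      open ≡-Reasoning
      y : Point
      y = x ⊕ unit d
      loop : fun f x ≡ (fun f x ⊕ unit (∂ x d)) ⊕ unit (opposite (∂ y d))
      loop = begin
        fun f x
          ≡⟨ cong (fun f) (⊕-unit-opposite x d) ⟨
        fun f (y ⊕ unit (opposite d))
          ≡⟨ ∂-step y (opposite d) ⟩
        fun f y ⊕ unit (∂ y (opposite d))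
          ≡⟨ cong₂ (λ p t → p ⊕ unit t) (∂-step x d) (∂-opposite y d) ⟩
        (fun f x ⊕ unit (∂ x d)) ⊕ unit (opposite (∂ y d))
          ∎

  ∂-backward : ∀ x e → ∂ (x ⊕ unit e) (opposite e) ≡ ∂ x (opposite e)
  ∂-backward x e =
    trans (sym (∂-forward (x ⊕ unit e) (opposite e))) (cong (λ y → ∂ y (opposite e)) (⊕-unit-opposite x e))

  -- The images of x + e and x + d have exactly the two common neighbours f x and
  -- f x + ∂ x e + ∂ x d; the image of x + e + d is one of them, and it is not f x.
  ∂-sideways : ∀ x e d → e ≢ d → d ≢ opposite e → ∂ (x ⊕ unit e) d ≡ ∂ x d
  ∂-sideways x e d e≢d d≢-e =
    conclude (common-neighbours (fun f x) (∂ x e) (∂ x d) z (λ eq → e≢d (∂-injective x eq)) adj-e adj-d)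
    where
      z : Point
      z = fun f ((x ⊕ unit e) ⊕ unit d)
      adj-e : Adj (fun f x ⊕ unit (∂ x e)) z
      adj-e = subst (λ y → Adj y z) (∂-step x e) (adj⇒ f _ _ (step-adjacent (x ⊕ unit e) d))
      adj-d : Adj (fun f x ⊕ unit (∂ x d)) z
      adj-d = subst₂ Adj (∂-step x d) (cong (fun f) (⊕-swap x (unit d) (unit e)))
                (adj⇒ f _ _ (step-adjacent (x ⊕ unit d) e))
      z-via-e : z ≡ (fun f x ⊕ unit (∂ x e)) ⊕ unit (∂ (x ⊕ unit e) d)
      z-via-e = trans (∂-step (x ⊕ unit e) d) (cong (_⊕ unit (∂ (x ⊕ unit e) d)) (∂-step x e))
      conclude : z ≡ fun f x ⊎ z ≡ (fun f x ⊕ unit (∂ x e)) ⊕ unit (∂ x d) → ∂ (x ⊕ unit e) d ≡ ∂ x d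
      conclude (inj₁ z≡fx) = ⊥-elim (d≢-e (units-cancel e d (⊕-returns x _ _ (fun-injective f z≡fx))))
      conclude (inj₂ z≡)   =
        unit-injective _ _ (⊕-cancelˡ (fun f x ⊕ unit (∂ x e)) _ _ (trans (sym z-via-e) z≡))

  ∂-translate : ∀ x e d → ∂ (x ⊕ unit e) d ≡ ∂ x d
  ∂-translate x e d = by-cases (e ≟ᵈ d) (d ≟ᵈ opposite e)
    where
      by-cases : Dec (e ≡ d) → Dec (d ≡ opposite e) → ∂ (x ⊕ unit e) d ≡ ∂ x d
      by-cases (yes refl) _          = ∂-forward x e
      by-cases (no _)     (yes refl) = ∂-backward x e
      by-cases (no e≢d)   (no d≢-e)  = ∂-sideways x e d e≢d d≢-e

  ∂-constant : ∀ x d → ∂ x d ≡ ∂ origin d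
  ∂-constant x d = step-invariant⇒constant (λ y → ∂ y d) (λ y e → ∂-translate y e d) x

record Affine (g : Point → Point) (M : Dir → Dir) : Set where
  constructor affine
  field maps-step : ∀ x e → g (x ⊕ unit e) ≡ g x ⊕ unit (M e)
open Affine

frame : Dir → Dir → Dir → Dir
frame a b R = a
frame a b L = opposite a
frame a b U = b
frame a b D = opposite b

automorphism-affine : ∀ f → ∃₂ λ a b → Affine (fun f) (frame a b)
automorphism-affine f = ∂ origin R , ∂ origin U , affine λ x e →
  trans (∂-step x e) (cong (λ d → fun f x ⊕ unit d) (trans (∂-constant x e) (framed e)))
  where
    open Derivative f
    framed : ∀ e → ∂ origin e ≡ frame (∂ origin R) (∂ origin U) e
    framed R = refl
    framed L = ∂-opposite origin R
    framed U = refl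
    framed D = ∂-opposite origin U

affine-∘ : ∀ {g g′ M M′} → Affine g M → Affine g′ M′ → Affine (λ x → g (g′ x)) (λ e → M (M′ e))
affine-∘ {g} aff aff′ = affine λ x e → trans (cong g (maps-step aff′ x e)) (maps-step aff _ _)

affine-≗ : ∀ {g M M′} → (∀ e → M e ≡ M′ e) → Affine g M → Affine g M′
affine-≗ {g} M≗M′ aff = affine λ x e → trans (maps-step aff x e) (cong (λ d → g x ⊕ unit d) (M≗M′ e))

affine-≉id : ∀ {g M d} → Affine g M → M d ≢ d → ¬ (∀ x → g x ≡ x)
affine-≉id {g} {M} {d} aff Md≢d g≗id = Md≢d (unit-injective _ _ (⊕-cancelˡ origin _ _ (begin
  origin ⊕ unit (M d)     ≡⟨ cong (_⊕ unit (M d)) (g≗id origin) ⟨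
  g origin ⊕ unit (M d)   ≡⟨ maps-step aff origin d ⟨
  g (origin ⊕ unit d)     ≡⟨ g≗id _ ⟩
  origin ⊕ unit d         ∎)))
  where open ≡-Reasoning

module _ {g : Point → Point} (g-injective : ∀ {x y} → g x ≡ g y → x ≡ y) where

  frame-repeats-⊥ : ∀ {a} → ¬ Affine g (frame a a)
  frame-repeats-⊥ aff with g-injective (trans (maps-step aff origin R) (sym (maps-step aff origin U)))
  ... | ()

  frame-reverses-⊥ : ∀ {a} → ¬ Affine g (frame a (opposite a))
  frame-reverses-⊥ {a} aff with g-injective (trans (maps-step aff (origin ⊕ unit R) U)
    (trans (cong (_⊕ unit (opposite a)) (maps-step aff origin R)) (⊕-unit-opposite (g origin) a)))
  ... | ()

record Additive (φ : Point → ℤ) : Set where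
  constructor additive
  field ⊕-homo : ∀ p q → φ (p ⊕ q) ≡ φ p + φ q
open Additive

proj₁-additive : Additive proj₁
proj₁-additive = additive λ _ _ → refl

proj₂-additive : Additive proj₂
proj₂-additive = additive λ _ _ → refl

neg-additive : ∀ {φ} → Additive φ → Additive (λ p → - φ p)
neg-additive {φ} φ-additive = additive λ p q →
  trans (cong -_ (⊕-homo φ-additive p q)) (ℤ.neg-distrib-+ (φ p) (φ q))

+-additive : ∀ {φ ψ} → Additive φ → Additive ψ → Additive (λ p → φ p + ψ p)
+-additive {φ} {ψ} φ-additive ψ-additive = additive λ p q →
  trans (cong₂ _+_ (⊕-homo φ-additive p q) (⊕-homo ψ-additive p q)) (interchange (φ p) (φ q) (ψ p) (ψ q))
  where
    interchange : ∀ a b c d → (a + b) + (c + d) ≡ (a + c) + (b + d)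
    interchange = solve-∀

drift : ∀ {g M φ ψ} → Affine g M → Additive φ → Additive ψ → (∀ e → φ (unit (M e)) ≡ ψ (unit e)) →
        ∃ λ κ → ∀ x → φ (g x) ≡ κ + ψ x
drift {g} {M} {φ} {ψ} aff φ-additive ψ-additive φM≗ψ = h origin , λ x →
  trans (rearrange (φ (g x)) (ψ x)) (cong (_+ ψ x) (step-invariant⇒constant h h-step x))
  where
    open ≡-Reasoning
    h : Point → ℤ
    h x = φ (g x) - ψ x
    rearrange : ∀ a b → a ≡ (a - b) + b
    rearrange = solve-∀
    regroup : ∀ a b c → (a + c) - (b + c) ≡ a - b
    regroup = solve-∀
    h-step : ∀ x e → h (x ⊕ unit e) ≡ h x
    h-step x e = begin
      φ (g (x ⊕ unit e)) - ψ (x ⊕ unit e)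
        ≡⟨ cong₂ _-_ (trans (cong φ (maps-step aff x e)) (⊕-homo φ-additive (g x) (unit (M e))))
                     (⊕-homo ψ-additive x (unit e)) ⟩
      (φ (g x) + φ (unit (M e))) - (ψ x + ψ (unit e))
        ≡⟨ cong (λ t → (φ (g x) + t) - (ψ x + ψ (unit e))) (φM≗ψ e) ⟩
      (φ (g x) + ψ (unit e)) - (ψ x + ψ (unit e))
        ≡⟨ regroup (φ (g x)) (ψ x) (ψ (unit e)) ⟩
      φ (g x) - ψ x
        ∎

finite-order-invariant : ∀ γ m {M φ} → (γ ^ᴬ suc m) ≈ᴬ idᴬ → Affine (fun γ) M → Additive φ →
                         (∀ e → φ (unit (M e)) ≡ φ (unit e)) → ∀ x → φ (fun γ x) ≡ φ x
finite-order-invariant γ m {M} {φ} γⁿ≈id aff φ-additive φM≗φ x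
  with drift aff φ-additive φ-additive φM≗φ
... | κ , shift = trans (shift x) (trans (cong (_+ φ x) κ≡0) (ℤ.+-identityˡ (φ x)))
  where
    regroup : ∀ c n a → c + (n * c + a) ≡ (+ 1 + n) * c + a
    regroup = solve-∀
    iterate : ∀ k y → φ (fun (γ ^ᴬ k) y) ≡ + k * κ + φ y
    iterate zero    y = sym (ℤ.+-identityˡ (φ y))
    iterate (suc k) y =
      trans (shift _) (trans (cong (λ t → κ + t) (iterate k y)) (regroup κ (+ k) (φ y)))
    κ≡0 : κ ≡ + 0
    κ≡0 = ℤ.*-cancelˡ-≡ (+ suc m) κ (+ 0) (trans
      (identityˡ-unique (+ suc m * κ) (φ x) (trans (sym (iterate (suc m) x)) (cong φ (γⁿ≈id x))))
      (sym (ℤ.*-zeroʳ (+ suc m))))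

SmallDisplacement : (Point → Point) → Set
SmallDisplacement g = ∃ λ x → ∃₂ λ r₁ r₂ → r₁ < 2 × r₂ < 2 × g x ≡ x ⊕ (+ r₁ , + r₂)

halve : ∀ c → ∃₂ λ k r → r < 2 × c - k ≡ k + + r
halve c = k , r , n%ℕd<d c 2 , (begin
  c - k                ≡⟨ cong (_- k) (a≡a%ℕn+[a/ℕn]*n c 2) ⟩
  (+ r + k * + 2) - k  ≡⟨ regroup (+ r) k ⟩
  k + + r              ∎)
  where
    open ≡-Reasoning
    k = c /ℕ 2
    r = c %ℕ 2
    regroup : ∀ r k → (r + k * + 2) - k ≡ k + r
    regroup = solve-∀

half-turn-small : ∀ {g} → Affine g opposite → SmallDisplacement g
half-turn-small aff =
  let κ₁ , drift₁ = drift aff proj₁-additive (neg-additive proj₁-additive)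
        λ { R → refl ; L → refl ; U → refl ; D → refl }
      κ₂ , drift₂ = drift aff proj₂-additive (neg-additive proj₂-additive)
        λ { R → refl ; L → refl ; U → refl ; D → refl }
      k₁ , r₁ , r₁<2 , e₁ = halve κ₁
      k₂ , r₂ , r₂<2 , e₂ = halve κ₂
  in (k₁ , k₂) , r₁ , r₂ , r₁<2 , r₂<2 , cong₂ _,_ (trans (drift₁ _) e₁) (trans (drift₂ _) e₂)

module _ (γ : Aut) (m : ℕ) (γⁿ≈id : (γ ^ᴬ suc m) ≈ᴬ idᴬ) where

  translation-trivial : Affine (fun γ) (λ e → e) → γ ≈ᴬ idᴬ
  translation-trivial aff x = cong₂ _,_
    (finite-order-invariant γ m γⁿ≈id aff proj₁-additive (λ _ → refl) x)
    (finite-order-invariant γ m γⁿ≈id aff proj₂-additive (λ _ → refl) x)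

  horizontal-reflection-small : Affine (fun γ) (frame R D) → SmallDisplacement (fun γ)
  horizontal-reflection-small aff =
    let fixed₁ = finite-order-invariant γ m γⁿ≈id aff proj₁-additive
          λ { R → refl ; L → refl ; U → refl ; D → refl }
        κ , drift₂ = drift aff proj₂-additive (neg-additive proj₂-additive)
          λ { R → refl ; L → refl ; U → refl ; D → refl }
        k , r , r<2 , e = halve κ
    in (+ 0 , k) , 0 , r , z<s , r<2 , cong₂ _,_ (fixed₁ _) (trans (drift₂ _) e)

  vertical-reflection-small : Affine (fun γ) (frame L U) → SmallDisplacement (fun γ)
  vertical-reflection-small aff =
    let fixed₂ = finite-order-invariant γ m γⁿ≈id aff proj₂-additive
          λ { R → refl ; L → refl ; U → refl ; D → refl }
        κ , drift₁ = drift aff proj₁-additive (neg-additive proj₁-additive)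
          λ { R → refl ; L → refl ; U → refl ; D → refl }
        k , r , r<2 , e = halve κ
    in (k , + 0) , r , 0 , r<2 , z<s , cong₂ _,_ (trans (drift₁ _) e) (fixed₂ _)

  diagonal-reflection-small : Affine (fun γ) (frame U R) → SmallDisplacement (fun γ)
  diagonal-reflection-small aff =
    let fixed-sum = finite-order-invariant γ m γⁿ≈id aff (+-additive proj₁-additive proj₂-additive)
          λ { R → refl ; L → refl ; U → refl ; D → refl }
        κ , drift₁ = drift aff proj₁-additive proj₂-additive
          λ { R → refl ; L → refl ; U → refl ; D → refl }
        x = κ , + 0
    in x , 0 , 0 , z<s , z<s , cong₂ _,_ (drift₁ x)
         (identityʳ-unique (proj₁ (fun γ x)) (proj₂ (fun γ x)) (trans (fixed-sum x) (sym (drift₁ x))))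

  antidiagonal-reflection-small : Affine (fun γ) (frame D L) → SmallDisplacement (fun γ)
  antidiagonal-reflection-small aff =
    let fixed-difference = finite-order-invariant γ m γⁿ≈id aff
          (+-additive proj₁-additive (neg-additive proj₂-additive)) λ { R → refl ; L → refl ; U → refl ; D → refl }
        κ , drift₁ = drift aff proj₁-additive (neg-additive proj₂-additive)
          λ { R → refl ; L → refl ; U → refl ; D → refl }
        x = κ , + 0
        -γx₂≡0 = identityʳ-unique (proj₁ (fun γ x)) (- proj₂ (fun γ x))
          (trans (fixed-difference x) (sym (drift₁ x)))
    in x , 0 , 0 , z<s , z<s , cong₂ _,_ (drift₁ x) (trans (sym (ℤ.neg-involutive _)) (cong -_ -γx₂≡0))

module _ (Γ : Subgroup) (displacement≥3 : MinDisplacementAtLeast 3 Γ) where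

  small-displacement-⊥ : ∀ {γ M} → _∈Γ Γ γ → Affine (fun γ) M → ∀ d → M d ≢ d → ¬ SmallDisplacement (fun γ)
  small-displacement-⊥ γ∈Γ aff d Md≢d (x , r₁ , r₂ , r₁<2 , r₂<2 , γx≡) =
    let n , n≤2 , walk = walk-to-corner x r₁<2 r₂<2
    in ℕ.≤⇒≯ n≤2 (displacement≥3 _ γ∈Γ (affine-≉id aff Md≢d) x n (subst (λ y → Walk x y n) (sym γx≡) walk))

  half-turn-⊥ : ∀ {γ} → _∈Γ Γ γ → ¬ Affine (fun γ) opposite
  half-turn-⊥ γ∈Γ aff = small-displacement-⊥ γ∈Γ aff R (λ ()) (half-turn-small aff)

  quarter-turn-⊥ : ∀ {γ M} → _∈Γ Γ γ → (∀ d → M (M d) ≡ opposite d) → ¬ Affine (fun γ) M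
  quarter-turn-⊥ γ∈Γ M²≗opposite aff = half-turn-⊥ (∘∈ Γ γ∈Γ γ∈Γ) (affine-≗ M²≗opposite (affine-∘ aff aff))

  finite-order-trivial : ∀ {γ} m → _∈Γ Γ γ → (γ ^ᴬ suc m) ≈ᴬ idᴬ → ∀ a b → Affine (fun γ) (frame a b) → γ ≈ᴬ idᴬ
  finite-order-trivial {γ} m γ∈Γ γⁿ≈id = classify
    where
      repeats : ∀ {a} → ¬ Affine (fun γ) (frame a a)
      repeats = frame-repeats-⊥ (fun-injective γ)
      reverses : ∀ {a} → ¬ Affine (fun γ) (frame a (opposite a))
      reverses = frame-reverses-⊥ (fun-injective γ)
      moves : ∀ {M} → Affine (fun γ) M → ∀ d → M d ≢ d → ¬ SmallDisplacement (fun γ)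
      moves = small-displacement-⊥ γ∈Γ
      classify : ∀ a b → Affine (fun γ) (frame a b) → γ ≈ᴬ idᴬ
      classify R R aff = ⊥-elim (repeats aff)
      classify R L aff = ⊥-elim (reverses aff)
      classify R U aff = translation-trivial γ m γⁿ≈id (affine-≗ (λ { R → refl ; L → refl ; U → refl ; D → refl }) aff)
      classify R D aff = ⊥-elim (moves aff U (λ ()) (horizontal-reflection-small γ m γⁿ≈id aff))
      classify L R aff = ⊥-elim (reverses aff)
      classify L L aff = ⊥-elim (repeats aff)
      classify L U aff = ⊥-elim (moves aff R (λ ()) (vertical-reflection-small γ m γⁿ≈id aff))
      classify L D aff = ⊥-elim (half-turn-⊥ γ∈Γ (affine-≗ (λ { R → refl ; L → refl ; U → refl ; D → refl }) aff))
      classify U R aff = ⊥-elim (moves aff R (λ ()) (diagonal-reflection-small γ m γⁿ≈id aff))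
      classify U L aff = ⊥-elim (quarter-turn-⊥ γ∈Γ (λ { R → refl ; L → refl ; U → refl ; D → refl }) aff)
      classify U U aff = ⊥-elim (repeats aff)
      classify U D aff = ⊥-elim (reverses aff)
      classify D R aff = ⊥-elim (quarter-turn-⊥ γ∈Γ (λ { R → refl ; L → refl ; U → refl ; D → refl }) aff)
      classify D L aff = ⊥-elim (moves aff R (λ ()) (antidiagonal-reflection-small γ m γⁿ≈id aff))
      classify D U aff = ⊥-elim (reverses aff)
      classify D D aff = ⊥-elim (repeats aff)

claim6 : (Γ : Subgroup) → MinDisplacementAtLeast 3 Γ → TorsionFree Γ
claim6 Γ displacement≥3 γ γ∈Γ (suc m) _ γⁿ≈id =
  let a , b , aff = automorphism-affine γ
  in finite-order-trivial Γ displacement≥3 m γ∈Γ γⁿ≈id a b aff
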